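{- Let $G=(V,E)$ be a claw-free graph and let $I$ be a maximum independent set of $G$. For distinct $a,b\in I$ let $V_{a,b}=\{v\in V\setminus I: N(v)\cap I=\{a,b\}\}$ and for $a\in I$ let $V_a=\{v\in V\setminus I: N(v)\cap I=\{a\}\}$; these sets are called packs, $a,b$ are the legs of $V_{a,b}$ and $a$ is the leg of $V_a$. If there is an edge between a pack $V_{a,b}$ and a distinct pack $X$, then $X$ and $V_{a,b}$ have a common leg, i.e., $X=V_a$ or $X=V_b$ or $X=V_{a,c}$ or $X=V_{b,c}$ for some $c\in I$.
   Context: A graph is claw-free if it has no induced subgraph isomorphic to $K_{1,3}$. (In this setting every vertex of $V\setminus I$ has one or two neighbours in $I$, so the packs partition $V\setminus I$.) -}

module Defs where

open import Data.Nat using (ℕ; _≤_)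
open import Data.Fin using (Fin)
open import Data.Fin.Subset using (Subset; _∈_; _∉_; ∣_∣)
open import Data.Product using (_×_; ∃-syntax)
open import Data.Sum using (_⊎_)
open import Data.Empty using (⊥)
open import Relation.Nullary using (¬_)
open import Relation.Binary.PropositionalEquality using (_≡_; _≢_)
open import Function.Bundles using (_⇔_)

record Graph (n : ℕ) : Set₁ where
  field
    Adj     : Fin n → Fin n → Set
    sym     : ∀ {u v} → Adj u v → Adj v u
    irrefl  : ∀ {u} → ¬ Adj u u
open Graph public

ClawFree : ∀ {n} → Graph n → Set
ClawFree {n} G = ¬ (∃[ v ] ∃[ x ] ∃[ y ] ∃[ z ]
  (Adj G v x × Adj G v y × Adj G v z ×
   x ≢ y × x ≢ z × y ≢ z ×
   ¬ Adj G x y × ¬ Adj G x z × ¬ Adj G y z))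

Independent : ∀ {n} → Graph n → Subset n → Set
Independent G J = ∀ u v → u ∈ J → v ∈ J → ¬ Adj G u v

MaximumIndependent : ∀ {n} → Graph n → Subset n → Set
MaximumIndependent {n} G I =
  Independent G I × (∀ (J : Subset n) → Independent G J → ∣ J ∣ ≤ ∣ I ∣)

-- Labels of packs: V_a (one leg a ∈ I) or V_{a,b} (distinct legs a, b ∈ I).
data PackLabel {n : ℕ} (I : Subset n) : Set where
  single : (a : Fin n) → a ∈ I → PackLabel I
  pair   : (a b : Fin n) → a ∈ I → b ∈ I → a ≢ b → PackLabel I

Leg : ∀ {n} {I : Subset n} → PackLabel I → Fin n → Set
Leg (single a _) u = u ≡ a
Leg (pair a b _ _ _) u = u ≡ a ⊎ u ≡ b

InPack : ∀ {n} (G : Graph n) (I : Subset n) → PackLabel I → Fin n → Set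
InPack G I p v = v ∉ I × (∀ u → u ∈ I → (Adj G v u ⇔ Leg p u))

module Submission where

-- Let v ∈ V_{a,b} be adjacent to w in a pack X. Then v is
-- adjacent to both legs a and b, which are distinct and non-adjacent since
-- I is independent, and w ∉ I differs from both. If w saw neither a nor b,
-- then v together with a, b, w would be a claw; hence w is adjacent to a or
-- to b. Since w lies in the pack X, its neighbours in I are exactly the
-- legs of X, so a or b is a leg of X, which is the common leg sought.

open import Defs
open import Data.Nat using (ℕ)
open import Data.Fin using (Fin; _≟_)
open import Data.Fin.Subset using (Subset; _∈_; _∉_)
open import Data.Product using (_×_; ∃-syntax; _,_)
open import Data.Sum using (inj₁; inj₂)
open import Data.Empty using (⊥-elim)
open import Relation.Nullary using (¬_; Dec; yes; no)
open import Relation.Nullary.Decidable using (_⊎-dec_)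
open import Relation.Binary.PropositionalEquality using (_≢_; refl; subst)
open import Function.Bundles using (_⇔_; Equivalence)

open Equivalence

-- Whether a vertex is a leg of a given pack is decidable; this replaces a
-- (non-available) decision of adjacency in the final case analysis.
leg? : ∀ {n} {I : Subset n} (X : PackLabel I) u → Dec (Leg X u)
leg? (single a _) u = u ≟ a
leg? (pair a b _ _ _) u = (u ≟ a) ⊎-dec (u ≟ b)

∈-∉-distinct : ∀ {n} {I : Subset n} {a w : Fin n} → a ∈ I → w ∉ I → a ≢ w
∈-∉-distinct {I = I} a∈I w∉I a≡w = w∉I (subst (_∈ I) a≡w a∈I)

pack-adj-leg : ∀ {n} (G : Graph n) (I : Subset n) (X : PackLabel I) {w u : Fin n} →
  InPack G I X w → u ∈ I → Leg X u → Adj G w u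
pack-adj-leg G I X (_ , nbhd) u∈I leg = from (nbhd _ u∈I) leg

non-leg-non-adj : ∀ {n} (G : Graph n) (I : Subset n) (X : PackLabel I) {w u : Fin n} →
  InPack G I X w → u ∈ I → ¬ Leg X u → ¬ Adj G u w
non-leg-non-adj G I X (_ , nbhd) u∈I ¬leg uw = ¬leg (to (nbhd _ u∈I) (Graph.sym G uw))

neighbour-of-pair-pack-sees-leg : ∀ {n} (G : Graph n) (I : Subset n) →
  ClawFree G → Independent G I →
  (a b : Fin n) (a∈I : a ∈ I) (b∈I : b ∈ I) (a≢b : a ≢ b) {v w : Fin n} →
  InPack G I (pair a b a∈I b∈I a≢b) v → w ∉ I → Adj G v w →
  ¬ (¬ Adj G a w × ¬ Adj G b w)
neighbour-of-pair-pack-sees-leg G I clawFree indep a b a∈I b∈I a≢b {v} {w}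
  v∈Vab w∉I vw (¬aw , ¬bw) =
  clawFree (v , a , b , w ,
    pack-adj-leg G I Vab v∈Vab a∈I (inj₁ refl) ,
    pack-adj-leg G I Vab v∈Vab b∈I (inj₂ refl) ,
    vw ,
    a≢b , ∈-∉-distinct a∈I w∉I , ∈-∉-distinct b∈I w∉I ,
    indep a b a∈I b∈I , ¬aw , ¬bw)
  where
  Vab : PackLabel I
  Vab = pair a b a∈I b∈I a≢b

-- Lemma 10: a pack adjacent to V_{a,b} shares a leg with it.
lemma10 : ∀ {n} (G : Graph n) (I : Subset n) → ClawFree G → MaximumIndependent G I →
    (a b : Fin n) (a∈I : a ∈ I) (b∈I : b ∈ I) (a≢b : a ≢ b) (X : PackLabel I) →
    ¬ (∀ u → Leg X u ⇔ Leg (pair a b a∈I b∈I a≢b) u) →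
    (∃[ v ] ∃[ w ] (InPack G I (pair a b a∈I b∈I a≢b) v × InPack G I X w × Adj G v w)) →
    ∃[ c ] (Leg X c × Leg (pair a b a∈I b∈I a≢b) c)
lemma10 G I clawFree (indep , _) a b a∈I b∈I a≢b X _ (v , w , v∈Vab , w∈X@(w∉I , _) , vw)
  with leg? X a | leg? X b
... | yes aLeg | _        = a , aLeg , inj₁ refl
... | no _     | yes bLeg = b , bLeg , inj₂ refl
... | no ¬aLeg | no ¬bLeg = ⊥-elim
  (neighbour-of-pair-pack-sees-leg G I clawFree indep a b a∈I b∈I a≢b
    v∈Vab w∉I vw
    (non-leg-non-adj G I X w∈X a∈I ¬aLeg , non-leg-non-adj G I X w∈X b∈I ¬bLeg))
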